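{- Let $\mathbf P=(P,\leq,{}',0,1)$ be an orthogonal orthocomplemented lub-complete poset. Then the following are equivalent: (i) $\mathbf P$ is a Boolean algebra; (ii) there exists a binary operator $\odot_C\colon P^2\to 2^P$ such that for all $x,y,z\in P$: $x\odot_C y\leq_1\{z\}$ if and only if $\{x\}\leq_2 y\rightarrow_C z$.
   Context: For a poset $(P,\leq)$ and $A\subseteq P$: $L(A)=\{x: x\leq a\ \forall a\in A\}$, $U(A)=\{x: a\leq x\ \forall a\in A\}$, $U(x,y)=U(\{x,y\})$; $\operatorname{Min}A$ is the set of minimal elements of $A$. For $A,B\subseteq P$: $A\leq_1 B$ iff for every $x\in A$ there is $y\in B$ with $x\leq y$; $A\leq_2 B$ iff for every $y\in B$ there is $x\in A$ with $x\leq y$. A bounded poset $(P,\leq,{}',0,1)$ with antitone involution: $x\leq y\Rightarrow y'\leq x'$, $x''=x$. $x\perp y$ iff $x\leq y'$. Orthogonal: $x\perp y$ implies the supremum $x\vee y$ exists. Orthocomplemented: $x\vee x'=1$ for all $x$. Lub-complete: for every finite $M\subseteq P$ and lower bound $x$ of $M$ there is a maximal element of $L(M)$ above $x$. Boolean algebra: $(P,\leq)$ is a distributive lattice with ${}'$ as complementation. Classical implication: $x\rightarrow_C y=\operatorname{Min}U(x',y)$. -}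

module Defs where

open import Data.Product using (Σ; ∃; _×_; _,_)
open import Data.Sum using (_⊎_)
open import Data.List using (List)
open import Data.List.Membership.Propositional using (_∈_)
open import Relation.Binary.PropositionalEquality using (_≡_)
open import Relation.Binary.Structures using (IsPartialOrder)

record BPAI : Set₁ where
  infix 4 _≤_
  infix 10 _′
  field
    Carrier        : Set
    _≤_            : Carrier → Carrier → Set
    isPartialOrder : IsPartialOrder _≡_ _≤_
    _′             : Carrier → Carrier
    𝟎 𝟏            : Carrier
    𝟎-least        : ∀ x → 𝟎 ≤ x
    𝟏-greatest     : ∀ x → x ≤ 𝟏
    antitone       : ∀ {x y} → x ≤ y → y ′ ≤ x ′
    involutive     : ∀ x → x ′ ′ ≡ x

module _ (P : BPAI) where
  open BPAI P

  Subset : Set₁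
  Subset = Carrier → Set

  ｛_｝ : Carrier → Subset
  ｛ z ｝ = λ w → w ≡ z

  Pair : Carrier → Carrier → Subset
  Pair x y = λ w → (w ≡ x) ⊎ (w ≡ y)

  L : Subset → Subset
  L A x = ∀ a → A a → x ≤ a

  U : Subset → Subset
  U A x = ∀ a → A a → a ≤ x

  Min : Subset → Subset
  Min A x = A x × (∀ y → A y → y ≤ x → y ≡ x)

  Max : Subset → Subset
  Max A x = A x × (∀ y → A y → x ≤ y → x ≡ y)

  _≤₁_ : Subset → Subset → Set
  A ≤₁ B = ∀ x → A x → ∃ λ y → B y × x ≤ y

  _≤₂_ : Subset → Subset → Set
  A ≤₂ B = ∀ y → B y → ∃ λ x → A x × x ≤ y

  IsSup : Carrier → Carrier → Carrier → Set
  IsSup x y s = x ≤ s × y ≤ s × (∀ u → x ≤ u → y ≤ u → s ≤ u)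

  IsInf : Carrier → Carrier → Carrier → Set
  IsInf x y i = i ≤ x × i ≤ y × (∀ l → l ≤ x → l ≤ y → l ≤ i)

  _⊥_ : Carrier → Carrier → Set
  x ⊥ y = x ≤ y ′

  Orthogonal : Set
  Orthogonal = ∀ x y → x ⊥ y → ∃ λ s → IsSup x y s

  Orthocomplemented : Set
  Orthocomplemented = ∀ x → IsSup x (x ′) 𝟏

  -- finite subsets M are given by lists
  LubComplete : Set
  LubComplete = ∀ (M : List Carrier) x → L (λ a → a ∈ M) x →
                ∃ λ m → Max (L (λ a → a ∈ M)) m × x ≤ m

  IsLattice : Set
  IsLattice = ∀ x y → (∃ λ s → IsSup x y s) × (∃ λ i → IsInf x y i)

  Distributive : Set
  Distributive = ∀ x y z s i j k → IsSup y z s → IsInf x s i →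
                 IsInf x y j → IsInf x z k → IsSup j k i

  Complemented : Set
  Complemented = ∀ x → IsSup x (x ′) 𝟏 × IsInf x (x ′) 𝟎

  BooleanAlgebra : Set
  BooleanAlgebra = IsLattice × Distributive × Complemented

  _→C_ : Carrier → Carrier → Subset
  x →C y = Min (U (Pair (x ′) y))

-- The set of consequences {z ∣ x ≤ y →C z} is closed under upper bounds of its lower bounds,
-- because every element of x ⊙ y is one of those lower bounds; read through this closure, the
-- adjunction says that a common lower bound of x and y below z forces x ≤ y →C z.  In particular
-- disjoint elements are orthogonal, so a maximal lower bound p of x and y (which exists by
-- lub-completeness) absorbs every common lower bound l: any r ≤ l, p′ is orthogonal to p,
-- and the maximality of p against r ∨ p gives r ≤ p ∧ p′ = 0.  The same adjunction yields
-- modus ponens x ≤ y, x ≤ y′ ∨ z ⇒ x ≤ z, which is what distributivity needs.  Conversely,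
-- in a Boolean algebra x ⊙ y = x ∧ y is adjoint to y′ ∨ z, the unique element of y →C z.
module Submission where

open import Defs
open import Data.Product using (∃; _,_; proj₁; proj₂)
open import Data.Sum using (inj₁; inj₂)
open import Data.List using (_∷_; [])
open import Data.List.Membership.Propositional using (_∈_)
open import Data.List.Relation.Unary.Any using (here; there)
open import Function.Base using (_∘_)
open import Function.Bundles using (_⇔_; mk⇔; Equivalence)
open import Function.Construct.Composition using (_⇔-∘_)
open import Function.Construct.Symmetry using (⇔-sym)
open import Function.Properties.Equivalence using (⇔-setoid)
open import Relation.Binary.PropositionalEquality using (refl; sym; subst)
open import Relation.Binary.Structures using (IsPartialOrder)
import Relation.Binary.Reasoning.Setoid as SetoidReasoning

open Equivalence using (to; from)

module Properties (P : BPAI) where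
  open BPAI P
  open IsPartialOrder isPartialOrder
    using (antisym; ≤-respˡ-≈; ≤-respʳ-≈) renaming (refl to ≤-refl; trans to ≤-trans)

  ⊥-sym : ∀ {x y} → x ≤ y ′ → y ≤ x ′
  ⊥-sym {y = y} x≤y′ = ≤-respˡ-≈ (involutive y) (antitone x≤y′)

  𝟏′≤𝟎 : 𝟏 ′ ≤ 𝟎
  𝟏′≤𝟎 = ≤-respʳ-≈ (involutive 𝟎) (antitone (𝟏-greatest (𝟎 ′)))

  infOfComplements⇒sup : ∀ {x y i} → IsInf P (x ′) (y ′) i → IsSup P x y (i ′)
  infOfComplements⇒sup (i≤x′ , i≤y′ , greatest) =
    ⊥-sym i≤x′ , ⊥-sym i≤y′ ,
    λ u x≤u y≤u → ≤-respʳ-≈ (involutive u) (antitone (greatest (u ′) (antitone x≤u) (antitone y≤u)))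

  IsSup-comm : ∀ {x y s} → IsSup P x y s → IsSup P y x s
  IsSup-comm (x≤s , y≤s , least) = y≤s , x≤s , λ u y≤u x≤u → least u x≤u y≤u

  IsSup-𝟎ʳ : ∀ x → IsSup P x 𝟎 x
  IsSup-𝟎ʳ x = ≤-refl , 𝟎-least x , λ _ x≤u _ → x≤u

  IsInf-𝟏ʳ : ∀ x → IsInf P x 𝟏 x
  IsInf-𝟏ʳ x = ≤-refl , 𝟏-greatest x , λ _ l≤x _ → l≤x

  U-Pair : ∀ {a b s} → a ≤ s → b ≤ s → U P (Pair P a b) s
  U-Pair a≤s _ _ (inj₁ refl) = a≤s
  U-Pair _ b≤s _ (inj₂ refl) = b≤s

  L-Pair : ∀ {a b x} → x ≤ a → x ≤ b → L P (λ c → c ∈ a ∷ b ∷ []) x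
  L-Pair x≤a _ _ (here refl) = x≤a
  L-Pair _ x≤b _ (there (here refl)) = x≤b
  L-Pair _ _ _ (there (there ()))

  sup⇒minUpper : ∀ {a b s} → IsSup P a b s → Min P (U P (Pair P a b)) s
  sup⇒minUpper (a≤s , b≤s , least) =
    U-Pair a≤s b≤s ,
    λ w w∈U w≤s → antisym w≤s (least w (w∈U _ (inj₁ refl)) (w∈U _ (inj₂ refl)))

  inf-U⇔≤ : ∀ {x y j z} → IsInf P x y j → U P (IsInf P x y) z ⇔ j ≤ z
  inf-U⇔≤ {j = j} j-inf =
    mk⇔ (λ infs≤z → infs≤z j j-inf)
        (λ { j≤z a (a≤x , a≤y , _) → ≤-trans (proj₂ (proj₂ j-inf) a a≤x a≤y) j≤z })

  ≤₁-｛｝ : ∀ {A z} → _≤₁_ P A (｛_｝ P z) ⇔ U P A z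
  ≤₁-｛｝ {A} {z} = mk⇔ ⇒ (λ z∈U a a∈A → z , refl , z∈U a a∈A)
    where
      ⇒ : _≤₁_ P A (｛_｝ P z) → U P A z
      ⇒ A≤z a a∈A with A≤z a a∈A
      ... | _ , refl , a≤z = a≤z

  ≤₂-｛｝ : ∀ {x A} → _≤₂_ P (｛_｝ P x) A ⇔ L P A x
  ≤₂-｛｝ {x} {A} = mk⇔ ⇒ (λ x∈L w w∈A → x , refl , x∈L w w∈A)
    where
      ⇒ : _≤₂_ P (｛_｝ P x) A → L P A x
      ⇒ x≤A w w∈A with x≤A w w∈A
      ... | _ , refl , x≤w = x≤w

  →C-≥ : ∀ {x y z} → x ≤ z → L P (_→C_ P y z) x
  →C-≥ x≤z w (w∈U , _) = ≤-trans x≤z (w∈U _ (inj₂ refl))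

  →C-sup : ∀ {x y z s} → IsSup P (y ′) z s → L P (_→C_ P y z) x ⇔ x ≤ s
  →C-sup s-sup@(_ , _ , least) =
    mk⇔ (λ x∈L → x∈L _ (sup⇒minUpper s-sup))
        (λ x≤s w (w∈U , _) → ≤-trans x≤s (least w (w∈U _ (inj₁ refl)) (w∈U _ (inj₂ refl))))

  →C-𝟎 : ∀ {x y} → L P (_→C_ P y 𝟎) x → x ≤ y ′
  →C-𝟎 {y = y} = to (→C-sup (IsSup-𝟎ʳ (y ′)))

  Disjoint : Carrier → Carrier → Set
  Disjoint x y = ∀ r → r ≤ x → r ≤ y → r ≤ 𝟎

  module Orthocomplement (oc : Orthocomplemented P) where

    disjoint-′ : ∀ x → Disjoint x (x ′)
    disjoint-′ x r r≤x r≤x′ = ≤-trans (⊥-sym 𝟏≤r′) 𝟏′≤𝟎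
      where
        𝟏≤r′ : 𝟏 ≤ r ′
        𝟏≤r′ = proj₂ (proj₂ (oc x)) (r ′) (⊥-sym r≤x′) (antitone r≤x)

    complemented : Complemented P
    complemented x = oc x , 𝟎-least x , 𝟎-least (x ′) , disjoint-′ x

    →C-self : ∀ {x y} → L P (_→C_ P y y) x
    →C-self {x} {y} w (w∈U , _) =
      ≤-trans (𝟏-greatest x) (proj₂ (proj₂ (oc y)) w (w∈U _ (inj₂ refl)) (w∈U _ (inj₁ refl)))

    maxLowerBound⇒inf : Orthogonal P → (∀ {x y} → Disjoint x y → x ≤ y ′) →
                        ∀ {c d p} → Max P (L P (λ a → a ∈ c ∷ d ∷ [])) p → IsInf P c d p
    maxLowerBound⇒inf orth disjoint⇒⊥ {c} {d} {p} (p∈L , maximal) = p≤c , p≤d , greatest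
      where
        p≤c : p ≤ c
        p≤c = p∈L c (here refl)
        p≤d : p ≤ d
        p≤d = p∈L d (there (here refl))

        absorbs : ∀ {r} → r ≤ c → r ≤ d → r ≤ p ′ → r ≤ p
        absorbs r≤c r≤d r≤p′ =
          let (q , r≤q , p≤q , least) = orth _ p r≤p′
              p≡q = maximal q (L-Pair (least c r≤c p≤c) (least d r≤d p≤d)) p≤q
          in ≤-respʳ-≈ (sym p≡q) r≤q

        greatest : ∀ l → l ≤ c → l ≤ d → l ≤ p
        greatest l l≤c l≤d = ≤-respʳ-≈ (involutive p) (disjoint⇒⊥ l∧p′≤𝟎)
          where
            l∧p′≤𝟎 : Disjoint l (p ′)
            l∧p′≤𝟎 r r≤l r≤p′ =
              disjoint-′ p r (absorbs (≤-trans r≤l l≤c) (≤-trans r≤l l≤d) r≤p′) r≤p′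

  module Residuated (oc : Orthocomplemented P) (⊙ : Carrier → Carrier → Subset P)
                    (adjoint : ∀ x y z → U P (⊙ x y) z ⇔ L P (_→C_ P y z) x) where
    open Orthocomplement oc

    Consequences : Carrier → Carrier → Subset P
    Consequences x y z = L P (_→C_ P y z) x

    Consequences-closed : ∀ {x y z} → U P (L P (Consequences x y)) z → Consequences x y z
    Consequences-closed {x} {y} {z} z∈UL = to (adjoint x y z) λ a a∈⊙ →
      z∈UL a (λ w w∈C → from (adjoint x y w) w∈C a a∈⊙)

    Consequences-cut : ∀ {x y z w} → Consequences x y z → (∀ r → r ≤ x → r ≤ z → r ≤ w) →
                       Consequences x y w
    Consequences-cut z∈C h = Consequences-closed λ r r∈L → h r (r∈L _ (→C-≥ ≤-refl)) (r∈L _ z∈C)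

    Consequences-intro : ∀ {x y z} → (∀ r → r ≤ x → r ≤ y → r ≤ z) → Consequences x y z
    Consequences-intro = Consequences-cut →C-self

    disjoint⇒⊥ : ∀ {x y} → Disjoint x y → x ≤ y ′
    disjoint⇒⊥ = →C-𝟎 ∘ Consequences-intro

    -- Contraposition: x ≤ y′ ∨ z = z′′ ∨ y′, so x ≤ z′ →C y′, and x ≤ y makes x ∧ y′ = 0.
    modus-ponens : ∀ {x y z s} → IsSup P (y ′) z s → x ≤ s → x ≤ y → x ≤ z
    modus-ponens {x} {y} {z} s-sup x≤s x≤y =
      ≤-respʳ-≈ (involutive z) (→C-𝟎 (Consequences-cut x∈C x∧y′≤𝟎))
      where
        x∈C : Consequences x (z ′) (y ′)
        x∈C = from (→C-sup (subst (λ t → IsSup P t (y ′) _) (sym (involutive z))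
                                  (IsSup-comm s-sup)))
                   x≤s
        x∧y′≤𝟎 : ∀ r → r ≤ x → r ≤ y ′ → r ≤ 𝟎
        x∧y′≤𝟎 r r≤x = disjoint-′ y r (≤-trans r≤x x≤y)

    module _ (orth : Orthogonal P) (lub : LubComplete P) where

      meet : ∀ x y → ∃ (IsInf P x y)
      meet x y =
        let (p , p-max , _) = lub (x ∷ y ∷ []) 𝟎 (L-Pair (𝟎-least x) (𝟎-least y))
        in p , maxLowerBound⇒inf orth disjoint⇒⊥ p-max

      join : ∀ x y → ∃ (IsSup P x y)
      join x y = let (i , i-inf) = meet (x ′) (y ′) in i ′ , infOfComplements⇒sup i-inf

      distributive : Distributive P
      distributive x y z s i j k (y≤s , z≤s , s-least) (i≤x , i≤s , i-greatest)
                   (j≤x , j≤y , j-greatest) (k≤x , k≤z , k-greatest) =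
        i-greatest j j≤x (≤-trans j≤y y≤s) , i-greatest k k≤x (≤-trans k≤z z≤s) , i-least
        where
          i-least : ∀ u → j ≤ u → k ≤ u → i ≤ u
          i-least u j≤u k≤u = modus-ponens t-sup (≤-trans i≤s s≤t) i≤x
            where
              t : Carrier
              t = proj₁ (join (x ′) u)
              t-sup : IsSup P (x ′) u t
              t-sup = proj₂ (join (x ′) u)
              s≤t : s ≤ t
              s≤t = s-least t
                (to (→C-sup t-sup) (Consequences-intro λ r r≤y r≤x →
                  ≤-trans (j-greatest r r≤x r≤y) j≤u))
                (to (→C-sup t-sup) (Consequences-intro λ r r≤z r≤x →
                  ≤-trans (k-greatest r r≤x r≤z) k≤u))

      boolean : BooleanAlgebra P
      boolean = (λ x y → join x y , meet x y) , distributive , complemented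

  module Boolean (ba : BooleanAlgebra P) where
    lattice : IsLattice P
    lattice = proj₁ ba

    distributive : Distributive P
    distributive = proj₁ (proj₂ ba)

    complemented : Complemented P
    complemented = proj₂ (proj₂ ba)

    residuation : ∀ {x y z j s} → IsInf P x y j → IsSup P (y ′) z s → j ≤ z ⇔ x ≤ s
    residuation {x} {y} {z} {j} {s} j-inf s-sup@(y′≤s , z≤s , _) = mk⇔ ⇒ ⇐
      where
        ⇒ : j ≤ z → x ≤ s
        ⇒ j≤z =
          let (k , k-inf@(_ , k≤y′ , _)) = proj₂ (lattice x (y ′))
              (_ , _ , x-least) = distributive x y (y ′) 𝟏 x j k
                                    (proj₁ (complemented y)) (IsInf-𝟏ʳ x) j-inf k-inf
          in x-least s (≤-trans j≤z z≤s) (≤-trans k≤y′ y′≤s)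

        ⇐ : x ≤ s → j ≤ z
        ⇐ x≤s =
          let (j≤x , j≤y , _) = j-inf
              (i , i-inf@(_ , _ , i-greatest)) = proj₂ (lattice y s)
              (k , k-inf@(_ , k≤z , _)) = proj₂ (lattice y z)
              (_ , _ , i-least) = distributive y (y ′) z s i 𝟎 k
                                    s-sup i-inf (proj₂ (complemented y)) k-inf
          in ≤-trans (i-greatest j j≤y (≤-trans j≤x x≤s)) (i-least z (𝟎-least z) k≤z)

    meet-adjoint : ∀ x y z → U P (IsInf P x y) z ⇔ L P (_→C_ P y z) x
    meet-adjoint x y z =
      let (j , j-inf) = proj₂ (lattice x y)
          (s , s-sup) = proj₁ (lattice (y ′) z)
          open SetoidReasoning (⇔-setoid _)
      in begin
        U P (IsInf P x y) z  ≈⟨ inf-U⇔≤ j-inf ⟩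
        j ≤ z                ≈⟨ residuation j-inf s-sup ⟩
        x ≤ s                ≈⟨ ⇔-sym (→C-sup s-sup) ⟩
        L P (_→C_ P y z) x   ∎

proposition3 : (P : BPAI) → Orthogonal P → Orthocomplemented P → LubComplete P →
    BooleanAlgebra P ⇔
      (∃ λ (⊙ : BPAI.Carrier P → BPAI.Carrier P → Subset P) →
        ∀ x y z → _⇔_ (_≤₁_ P (⊙ x y) (｛_｝ P z)) (_≤₂_ P (｛_｝ P x) (_→C_ P y z)))
proposition3 P orth oc lub = mk⇔
  (λ ba → IsInf P , λ x y z → ⇔-sym ≤₂-｛｝ ⇔-∘ (Boolean.meet-adjoint ba x y z ⇔-∘ ≤₁-｛｝))
  (λ (⊙ , adjoint) → Residuated.boolean oc ⊙
    (λ x y z → ≤₂-｛｝ ⇔-∘ (adjoint x y z ⇔-∘ ⇔-sym ≤₁-｛｝)) orth lub)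
  where open Properties P
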